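{- Let $i$ be a positive integer, let $D$ be an $(i,2)$ digraph, let $H$ be a hole of length $l \geq 5$ in $U(D)$, and let $C$ be the cycle obtained from $H$ by $\Gamma_H$. Suppose that $C$ has a chord $uv$ in $P(D)$. Then: (1) there is exactly one vertex $w$ taking care of $uv$ in $D$; (2) $w$ is the only out-neighbor in $V(D)-V(H)$ of each of $u$ and $v$; (3) if $T$ is the connected component containing $uv$ of the subgraph of $P(D)$ formed by the chords of $C$ (edge set: the chords of $C$; vertex set: their endpoints), then $w$ is a common out-neighbor in $D$ of all vertices of $T$, and $V(T)$ forms a clique in $P(D)$.
   Context: An $(i,j)$ digraph is an acyclic digraph in which every vertex has indegree at most $i$ and outdegree at most $j$. $U(D)$ is the underlying graph of $D$ (edge $uv$ iff $(u,v)$ or $(v,u)$ is an arc). The phylogeny graph $P(D)$ has vertex set $V(D)$ and an edge between distinct $u,v$ iff $(u,v)\in A(D)$ or $(v,u)\in A(D)$ or $u,v$ have a common out-neighbor. An edge of $P(D)$ that is not an edge of $U(D)$ is a cared edge; a vertex $w$ takes care of it if $w$ is a common out-neighbor of its ends. A hole is an induced cycle of length at least $4$. A chord of a cycle $C$ in $P(D)$ is an edge of $P(D)$ joining two vertices nonconsecutive on $C$. For a hole $H=v_1\cdots v_lv_1$ of $U(D)$ with $l\ge 5$, $\Gamma_H$ is the set of vertices of $H$ with exactly two in-neighbors in the subdigraph $D_H$ of $D$ induced by $V(H)$ (no two consecutive on $H$), and the cycle obtained from $H$ by $\Gamma_H$ is the cycle in $P(D)$ on $V(H)-\Gamma_H$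 in the cyclic order of $H$ (each path $v_{a-1}v_av_{a+1}$ with $v_a\in\Gamma_H$ replaced by the edge $v_{a-1}v_{a+1}$). -}

module Defs where

open import Data.Nat using (ℕ; zero; suc; _+_; _≤_; _<_)
open import Data.Fin using (Fin; toℕ)
import Data.Fin as F
open import Data.Bool using (Bool; true; false; if_then_else_)
open import Data.Product using (Σ; _×_; ∃; _,_)
open import Data.Sum using (_⊎_)
open import Relation.Binary.PropositionalEquality using (_≡_; _≢_)
open import Relation.Nullary using (¬_)
open import Relation.Binary.Construct.Closure.ReflexiveTransitive using (Star)

Digraph : ℕ → Set
Digraph n = Fin n → Fin n → Bool

module _ {n : ℕ} (D : Digraph n) where

  Arc : Fin n → Fin n → Set
  Arc u v = D u v ≡ true

  data DPath : Fin n → Fin n → Set where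
    one  : ∀ {u v} → Arc u v → DPath u v
    cons : ∀ {u w v} → Arc u w → DPath w v → DPath u v

  Acyclic : Set
  Acyclic = ∀ v → ¬ DPath v v

countTrue : ∀ {m} → (Fin m → Bool) → ℕ
countTrue {zero}  f = 0
countTrue {suc m} f = (if f F.zero then 1 else 0) + countTrue (λ k → f (F.suc k))

module _ {n : ℕ} (D : Digraph n) where

  indeg : Fin n → ℕ
  indeg v = countTrue (λ u → D u v)

  outdeg : Fin n → ℕ
  outdeg u = countTrue (λ v → D u v)

  IJDigraph : ℕ → ℕ → Set
  IJDigraph i j = Acyclic D × (∀ v → indeg v ≤ i) × (∀ v → outdeg v ≤ j)

  UAdj : Fin n → Fin n → Set
  UAdj u v = Arc D u v ⊎ Arc D v u

  CommonOut : Fin n → Fin n → Fin n → Set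
  CommonOut u v w = Arc D u w × Arc D v w

  PAdj : Fin n → Fin n → Set
  PAdj u v = u ≢ v × (UAdj u v ⊎ ∃ λ w → CommonOut u v w)

  TakesCare : Fin n → Fin n → Fin n → Set
  TakesCare u v w = PAdj u v × ¬ UAdj u v × CommonOut u v w

Consec : ∀ {l} → Fin l → Fin l → Set
Consec {l} a b =
    toℕ b ≡ suc (toℕ a)
  ⊎ toℕ a ≡ suc (toℕ b)
  ⊎ (toℕ a ≡ 0 × suc (toℕ b) ≡ l)
  ⊎ (toℕ b ≡ 0 × suc (toℕ a) ≡ l)

FwdInterior : ∀ {l} → Fin l → Fin l → Fin l → Set
FwdInterior a b k =
    (toℕ a < toℕ b × toℕ a < toℕ k × toℕ k < toℕ b)
  ⊎ (toℕ b < toℕ a × (toℕ a < toℕ k ⊎ toℕ k < toℕ b))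

module _ {n : ℕ} (D : Digraph n) where

  -- h : Fin l → Fin n lists the vertices of a cycle v_1 ⋯ v_l in cyclic order.
  IsHole : (l : ℕ) → (Fin l → Fin n) → Set
  IsHole l h =
    4 ≤ l × (∀ a b → h a ≡ h b → a ≡ b)
          × (∀ a b → (UAdj D (h a) (h b) → Consec a b) × (Consec a b → UAdj D (h a) (h b)))

  module _ {l : ℕ} (h : Fin l → Fin n) where

    indegH : Fin l → ℕ
    indegH a = countTrue (λ b → D (h b) (h a))

    InΓ : Fin l → Set
    InΓ a = indegH a ≡ 2

    InC : Fin l → Set
    InC a = ¬ InΓ a

    -- consecutive on the cycle C obtained from H by Γ_H: distinct vertices of C
    -- such that one of the two arcs of H between them has all interior vertices in Γ_H
    -- (i.e. no vertex of C strictly between them in the cyclic order of H)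
    CConsec : Fin l → Fin l → Set
    CConsec a b = a ≢ b × ((∀ k → FwdInterior a b k → InΓ k) ⊎ (∀ k → FwdInterior b a k → InΓ k))

    Chord : Fin l → Fin l → Set
    Chord a b = InC a × InC b × PAdj D (h a) (h b) × ¬ CConsec a b

    InChordComp : Fin l → Fin l → Set
    InChordComp a c = Star Chord a c

-- A vertex u of C is not in Γ_H, so one of its two neighbours on H is an out-neighbour of u;
-- as u has outdegree at most 2, it has at most one out-neighbour off H.  A chord uv of C is not
-- an edge of U(D), since H is induced and vertices consecutive on H stay consecutive on C, so u
-- and v have a common out-neighbour w.  This w is off H: otherwise u and v would be the two
-- neighbours of w on H, both pointing to w, so w ∈ Γ_H and u, v would be consecutive on C.
-- Hence w is the unique out-neighbour off H of both ends of the chord, and applying this to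
-- every chord of T carries w along T.
module Submission where

open import Defs
open import Data.Nat using (ℕ; zero; suc; _+_; _≤_; _<_; z≤n; s≤s; s≤s⁻¹; _≟_)
open import Data.Nat.Properties
  using (suc-injective; ≤-antisym; ≤-trans; n≤1+n; <⇒≢; <⇒≱; <-asym; n<1+n; n<1⇒n≡0; m≢1+n+m; m≤n+m;
         ≤∧≢⇒<; +-commutativeSemigroup)
open import Data.Fin using (Fin; toℕ; fromℕ; fromℕ<; inject₁; punchIn; punchOut)
import Data.Fin as F
open import Data.Fin.Properties
  using (toℕ-injective; toℕ<n; toℕ-fromℕ; toℕ-fromℕ<; toℕ-inject₁;
         punchIn-punchOut; punchInᵢ≢i; punchIn-injective; punchOut-injective)
open import Data.Bool using (Bool; true; if_then_else_)
open import Data.Bool.Properties using (¬-not)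
open import Data.Product using (∃; ∃₂; _×_; _,_; proj₁; proj₂)
open import Data.Sum using (_⊎_; inj₁; inj₂; [_,_])
open import Data.Empty using (⊥; ⊥-elim)
open import Function using (_∘_)
open import Relation.Nullary using (¬_; contradiction; yes; no)
open import Relation.Binary.PropositionalEquality using (_≡_; _≢_; refl; sym; trans; cong; subst)
open import Relation.Binary.Construct.Closure.ReflexiveTransitive using (ε; _◅_)
open import Algebra.Properties.CommutativeSemigroup +-commutativeSemigroup using (x∙yz≈y∙xz)

countTrue-punchIn : ∀ {m} (f : Fin (suc m) → Bool) x →
                    countTrue f ≡ (if f x then 1 else 0) + countTrue (f ∘ punchIn x)
countTrue-punchIn f F.zero = refl
countTrue-punchIn {suc m} f (F.suc x) =
  trans (cong ((if f F.zero then 1 else 0) +_) (countTrue-punchIn (f ∘ F.suc) x))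
        (x∙yz≈y∙xz (if f F.zero then 1 else 0) (if f (F.suc x) then 1 else 0) _)

countTrue-punchIn-true : ∀ {m} (f : Fin (suc m) → Bool) {x} → f x ≡ true →
                 countTrue f ≡ suc (countTrue (f ∘ punchIn x))
countTrue-punchIn-true f {x} fx =
  subst (λ b → countTrue f ≡ (if b then 1 else 0) + countTrue (f ∘ punchIn x)) fx (countTrue-punchIn f x)

countTrue-allFalse : ∀ {m} (f : Fin m → Bool) → (∀ k → f k ≢ true) → countTrue f ≡ 0
countTrue-allFalse {zero} f none = refl
countTrue-allFalse {suc m} f none rewrite ¬-not (none F.zero) = countTrue-allFalse (f ∘ F.suc) (none ∘ F.suc)

punchIn-punchOut-true : ∀ {m} (f : Fin (suc m) → Bool) {x y} (x≢y : x ≢ y) → f y ≡ true →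
                        f (punchIn x (punchOut x≢y)) ≡ true
punchIn-punchOut-true f x≢y fy = trans (cong f (punchIn-punchOut x≢y)) fy

countTrue-≥1 : ∀ {m} (f : Fin m → Bool) {x} → f x ≡ true → 1 ≤ countTrue f
countTrue-≥1 {suc m} f fx rewrite countTrue-punchIn-true f fx = s≤s z≤n

countTrue-≥2 : ∀ {m} (f : Fin m → Bool) {x y} → x ≢ y → f x ≡ true → f y ≡ true → 2 ≤ countTrue f
countTrue-≥2 {suc m} f x≢y fx fy rewrite countTrue-punchIn-true f fx =
  s≤s (countTrue-≥1 (f ∘ punchIn _) (punchIn-punchOut-true f x≢y fy))

countTrue-≥3 : ∀ {m} (f : Fin m → Bool) {x y z} → x ≢ y → x ≢ z → y ≢ z →
               f x ≡ true → f y ≡ true → f z ≡ true → 3 ≤ countTrue f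
countTrue-≥3 {suc m} f x≢y x≢z y≢z fx fy fz rewrite countTrue-punchIn-true f fx =
  s≤s (countTrue-≥2 (f ∘ punchIn _) (y≢z ∘ punchOut-injective x≢y x≢z)
        (punchIn-punchOut-true f x≢y fy) (punchIn-punchOut-true f x≢z fz))

countTrue-≡2 : ∀ {m} (f : Fin m → Bool) {x y} → x ≢ y → f x ≡ true → f y ≡ true →
               (∀ z → f z ≡ true → z ≡ x ⊎ z ≡ y) → countTrue f ≡ 2
countTrue-≡2 {suc zero} f {F.zero} {F.zero} x≢y _ _ _ = contradiction refl x≢y
countTrue-≡2 {suc (suc m)} f {x} {y} x≢y fx fy only
  rewrite countTrue-punchIn-true f fx | countTrue-punchIn-true (f ∘ punchIn x) (punchIn-punchOut-true f x≢y fy) =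
  cong (suc ∘ suc) (countTrue-allFalse _ λ k fk → neither k (only _ fk))
  where
    y′ : Fin (suc m)
    y′ = punchOut x≢y
    neither : ∀ k → ¬ (punchIn x (punchIn y′ k) ≡ x ⊎ punchIn x (punchIn y′ k) ≡ y)
    neither k (inj₁ e) = punchInᵢ≢i x _ e
    neither k (inj₂ e) = punchInᵢ≢i y′ k (punchIn-injective x _ _ (trans e (sym (punchIn-punchOut x≢y))))

-- CycSuccℕ L a b: b follows a on the cycle 0 → 1 → ⋯ → L-1 → 0.  Consec is its symmetric
-- closure, and FwdInterior a b k unfolds to Interiorℕ (toℕ a) (toℕ b) (toℕ k).
CycSuccℕ : ℕ → ℕ → ℕ → Set
CycSuccℕ L a b = b ≡ suc a ⊎ (b ≡ 0 × suc a ≡ L)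

Interiorℕ : ℕ → ℕ → ℕ → Set
Interiorℕ a b k = (a < b × a < k × k < b) ⊎ (b < a × (a < k ⊎ k < b))

cycSuccℕ-functional : ∀ {L a b c} → b < L → c < L → CycSuccℕ L a b → CycSuccℕ L a c → b ≡ c
cycSuccℕ-functional _  _  (inj₁ refl)       (inj₁ refl)       = refl
cycSuccℕ-functional bL _  (inj₁ refl)       (inj₂ (_ , e))    = contradiction e (<⇒≢ bL)
cycSuccℕ-functional _  cL (inj₂ (_ , e))    (inj₁ refl)       = contradiction e (<⇒≢ cL)
cycSuccℕ-functional _  _  (inj₂ (refl , _)) (inj₂ (refl , _)) = refl

cycSuccℕ-injective : ∀ {L a b c} → CycSuccℕ L a c → CycSuccℕ L b c → a ≡ b
cycSuccℕ-injective (inj₁ refl)       (inj₁ e)        = suc-injective e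
cycSuccℕ-injective (inj₁ refl)       (inj₂ (() , _))
cycSuccℕ-injective (inj₂ (refl , _)) (inj₁ ())
cycSuccℕ-injective (inj₂ (_ , e))    (inj₂ (_ , e′)) = suc-injective (trans e (sym e′))

cycSuccℕ-noInterior : ∀ {L a b k} → k < L → CycSuccℕ L a b → ¬ Interiorℕ a b k
cycSuccℕ-noInterior _  (inj₁ refl)          (inj₁ (_ , a<k , k<b))  = <⇒≱ a<k (s≤s⁻¹ k<b)
cycSuccℕ-noInterior _  (inj₁ refl)          (inj₂ (b<a , _))        = <-asym (n<1+n _) b<a
cycSuccℕ-noInterior _  (inj₂ (refl , _))    (inj₁ (() , _))
cycSuccℕ-noInterior kL (inj₂ (refl , refl)) (inj₂ (_ , inj₁ a<k)) = <⇒≱ a<k (s≤s⁻¹ kL)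
cycSuccℕ-noInterior _  (inj₂ (refl , _))    (inj₂ (_ , inj₂ ()))

cycSuccℕ-twoStepInterior : ∀ {L p k q j} → j < L → CycSuccℕ L p k → CycSuccℕ L k q →
                           Interiorℕ p q j → j ≡ k
cycSuccℕ-twoStepInterior _  (inj₁ refl) (inj₁ refl) (inj₁ (_ , p<j , j<q)) = ≤-antisym (s≤s⁻¹ j<q) p<j
cycSuccℕ-twoStepInterior _  (inj₁ refl) (inj₁ refl) (inj₂ (q<p , _)) = contradiction (m≤n+m _ 2) (<⇒≱ q<p)
cycSuccℕ-twoStepInterior _  (inj₁ refl) (inj₂ (refl , _)) (inj₁ (() , _))
cycSuccℕ-twoStepInterior jL (inj₁ refl) (inj₂ (refl , refl)) (inj₂ (_ , inj₁ p<j)) =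
  ≤-antisym (s≤s⁻¹ jL) p<j
cycSuccℕ-twoStepInterior _  (inj₁ refl) (inj₂ (refl , _)) (inj₂ (_ , inj₂ ()))
cycSuccℕ-twoStepInterior _  (inj₂ (refl , _)) (inj₁ refl) (inj₁ (_ , _ , j<1)) = n<1⇒n≡0 j<1
cycSuccℕ-twoStepInterior jL (inj₂ (refl , refl)) (inj₁ refl) (inj₂ (_ , inj₁ p<j)) =
  contradiction (s≤s⁻¹ jL) (<⇒≱ p<j)
cycSuccℕ-twoStepInterior _  (inj₂ (refl , _)) (inj₁ refl) (inj₂ (_ , inj₂ j<1)) = n<1⇒n≡0 j<1
cycSuccℕ-twoStepInterior _  (inj₂ (refl , _)) (inj₂ (refl , _)) (inj₁ (() , _))
cycSuccℕ-twoStepInterior _  (inj₂ (refl , refl)) (inj₂ (refl , ())) (inj₂ (s≤s _ , _))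

cycSuccℕ-no2Cycle : ∀ {L a b} → 3 ≤ L → CycSuccℕ L a b → CycSuccℕ L b a → ⊥
cycSuccℕ-no2Cycle _ (inj₁ refl) (inj₁ e) = m≢1+n+m _ e
cycSuccℕ-no2Cycle (s≤s (s≤s (s≤s _))) (inj₁ refl) (inj₂ (refl , ()))
cycSuccℕ-no2Cycle (s≤s (s≤s (s≤s _))) (inj₂ (refl , ())) (inj₁ refl)
cycSuccℕ-no2Cycle (s≤s (s≤s (s≤s _))) (inj₂ (refl , ())) (inj₂ (refl , _))

CycSucc : ∀ {l} → Fin l → Fin l → Set
CycSucc {l} a b = CycSuccℕ l (toℕ a) (toℕ b)

cycSucc-exists : ∀ {l} (a : Fin l) → ∃ λ b → CycSucc a b
cycSucc-exists {suc m} a with suc (toℕ a) ≟ suc m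
... | yes 1+a≡l = F.zero , inj₂ (refl , 1+a≡l)
... | no  1+a≢l = fromℕ< 1+a<l , inj₁ (toℕ-fromℕ< 1+a<l)
  where 1+a<l : suc (toℕ a) < suc m
        1+a<l = ≤∧≢⇒< (toℕ<n a) 1+a≢l

cycPred-exists : ∀ {l} (b : Fin l) → ∃ λ a → CycSucc a b
cycPred-exists {suc m} F.zero    = fromℕ m , inj₂ (refl , cong suc (toℕ-fromℕ m))
cycPred-exists {suc m} (F.suc b) = inject₁ b , inj₁ (cong suc (sym (toℕ-inject₁ b)))

module _ {l : ℕ} where

  consec⇒cycSucc : ∀ {a b : Fin l} → Consec a b → CycSucc a b ⊎ CycSucc b a
  consec⇒cycSucc (inj₁ e)                = inj₁ (inj₁ e)
  consec⇒cycSucc (inj₂ (inj₁ e))         = inj₂ (inj₁ e)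
  consec⇒cycSucc (inj₂ (inj₂ (inj₁ e)))  = inj₂ (inj₂ e)
  consec⇒cycSucc (inj₂ (inj₂ (inj₂ e)))  = inj₁ (inj₂ e)

  cycSucc⇒consec : ∀ {a b : Fin l} → CycSucc a b → Consec a b
  cycSucc⇒consec (inj₁ e) = inj₁ e
  cycSucc⇒consec (inj₂ e) = inj₂ (inj₂ (inj₂ e))

  cycSucc⇒consec˘ : ∀ {a b : Fin l} → CycSucc b a → Consec a b
  cycSucc⇒consec˘ (inj₁ e) = inj₂ (inj₁ e)
  cycSucc⇒consec˘ (inj₂ e) = inj₂ (inj₂ (inj₁ e))

  cycSucc-functional : ∀ {a b c : Fin l} → CycSucc a b → CycSucc a c → b ≡ c
  cycSucc-functional {b = b} {c} ab ac = toℕ-injective (cycSuccℕ-functional (toℕ<n b) (toℕ<n c) ab ac)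

  cycSucc-injective : ∀ {a b c : Fin l} → CycSucc a c → CycSucc b c → a ≡ b
  cycSucc-injective ac bc = toℕ-injective (cycSuccℕ-injective ac bc)

  consec-noInterior : ∀ {a b : Fin l} → Consec a b →
                      (∀ k → ¬ FwdInterior a b k) ⊎ (∀ k → ¬ FwdInterior b a k)
  consec-noInterior c with consec⇒cycSucc c
  ... | inj₁ ab = inj₁ λ k → cycSuccℕ-noInterior (toℕ<n k) ab
  ... | inj₂ ba = inj₂ λ k → cycSuccℕ-noInterior (toℕ<n k) ba

  consec-commonNeighbour : ∀ {a b k : Fin l} → a ≢ b → Consec a k → Consec b k →
                           (∀ j → FwdInterior a b j → j ≡ k) ⊎ (∀ j → FwdInterior b a j → j ≡ k)
  consec-commonNeighbour a≢b a~k b~k with consec⇒cycSucc a~k | consec⇒cycSucc b~k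
  ... | inj₁ ak | inj₁ bk = contradiction (cycSucc-injective ak bk) a≢b
  ... | inj₁ ak | inj₂ kb = inj₁ λ j → toℕ-injective ∘ cycSuccℕ-twoStepInterior (toℕ<n j) ak kb
  ... | inj₂ ka | inj₁ bk = inj₂ λ j → toℕ-injective ∘ cycSuccℕ-twoStepInterior (toℕ<n j) bk ka
  ... | inj₂ ka | inj₂ kb = contradiction (cycSucc-functional ka kb) a≢b

  consec-atMostTwo : ∀ {a b k z : Fin l} → a ≢ b → Consec a k → Consec b k → Consec z k →
                     z ≡ a ⊎ z ≡ b
  consec-atMostTwo a≢b a~k b~k z~k with consec⇒cycSucc a~k | consec⇒cycSucc b~k | consec⇒cycSucc z~k
  ... | inj₁ ak | inj₁ bk | _       = contradiction (cycSucc-injective ak bk) a≢b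
  ... | inj₂ ka | inj₂ kb | _       = contradiction (cycSucc-functional ka kb) a≢b
  ... | inj₁ ak | inj₂ _  | inj₁ zk = inj₁ (cycSucc-injective zk ak)
  ... | inj₁ _  | inj₂ kb | inj₂ kz = inj₂ (cycSucc-functional kz kb)
  ... | inj₂ ka | inj₁ _  | inj₂ kz = inj₁ (cycSucc-functional kz ka)
  ... | inj₂ _  | inj₁ bk | inj₁ zk = inj₂ (cycSucc-injective zk bk)

  twoNeighbours : 3 ≤ l → (k : Fin l) → ∃₂ λ p q → p ≢ q × Consec p k × Consec q k
  twoNeighbours 3≤l k with cycPred-exists k | cycSucc-exists k
  ... | p , pk | q , kq =
    p , q , (λ { refl → cycSuccℕ-no2Cycle 3≤l pk kq }) , cycSucc⇒consec pk , cycSucc⇒consec˘ kq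

module Hole {n : ℕ} (D : Digraph n) {l : ℕ} (h : Fin l → Fin n) (hole : IsHole D l h) where

  OffHole : Fin n → Set
  OffHole x = ∀ k → h k ≢ x

  private
    3≤l : 3 ≤ l
    3≤l = ≤-trans (n≤1+n 3) (proj₁ hole)

    adj⇒consec : ∀ {a b} → UAdj D (h a) (h b) → Consec a b
    adj⇒consec {a} {b} = proj₁ (proj₂ (proj₂ hole) a b)

    consec⇒adj : ∀ {a b} → Consec a b → UAdj D (h a) (h b)
    consec⇒adj {a} {b} = proj₂ (proj₂ (proj₂ hole) a b)

  inΓ-if-twoInArcs : ∀ {a b k} → a ≢ b → Consec a k → Consec b k →
                     Arc D (h a) (h k) → Arc D (h b) (h k) → InΓ D h k
  inΓ-if-twoInArcs a≢b ak bk a→k b→k =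
    countTrue-≡2 _ a≢b a→k b→k λ z z→k → consec-atMostTwo a≢b ak bk (adj⇒consec (inj₁ z→k))

  inC⇒outArcAlongHole : ∀ {a} → InC D h a → ∃ λ p → Arc D (h a) (h p)
  inC⇒outArcAlongHole {a} a∈C with twoNeighbours 3≤l a
  ... | p , q , p≢q , pa , qa with consec⇒adj pa | consec⇒adj qa
  ...   | inj₂ a→p | _        = p , a→p
  ...   | inj₁ _   | inj₂ a→q = q , a→q
  ...   | inj₁ p→a | inj₁ q→a = contradiction (inΓ-if-twoInArcs p≢q pa qa p→a q→a) a∈C

  adj⇒cConsec : ∀ {a b} → a ≢ b → UAdj D (h a) (h b) → CConsec D h a b
  adj⇒cConsec a≢b ab with consec-noInterior (adj⇒consec ab)
  ... | inj₁ none = a≢b , inj₁ λ k → ⊥-elim ∘ none k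
  ... | inj₂ none = a≢b , inj₂ λ k → ⊥-elim ∘ none k

  commonOut-offHole : ∀ {a b w} → a ≢ b → ¬ CConsec D h a b → CommonOut D (h a) (h b) w → OffHole w
  commonOut-offHole {a} {b} a≢b ¬ab (a→w , b→w) k refl =
    ¬ab (a≢b , [ inj₁ ∘ insideΓ , inj₂ ∘ insideΓ ] (consec-commonNeighbour a≢b ak bk))
    where
      ak : Consec a k
      ak = adj⇒consec (inj₁ a→w)
      bk : Consec b k
      bk = adj⇒consec (inj₁ b→w)
      insideΓ : ∀ {x y} → (∀ j → FwdInterior x y j → j ≡ k) → ∀ j → FwdInterior x y j → InΓ D h j
      insideΓ only-k j j∈xy = subst (InΓ D h) (sym (only-k j j∈xy)) (inΓ-if-twoInArcs a≢b ak bk a→w b→w)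

  chord⇒commonOut : ∀ {a b} → Chord D h a b → ∃ λ w → CommonOut D (h a) (h b) w
  chord⇒commonOut (_ , _ , (_ , inj₂ common) , _) = common
  chord⇒commonOut (_ , _ , (ha≢hb , inj₁ ab) , ¬ab) = contradiction (adj⇒cConsec (ha≢hb ∘ cong h) ab) ¬ab

  chord-commonOut-offHole : ∀ {a b w} → Chord D h a b → CommonOut D (h a) (h b) w → OffHole w
  chord-commonOut-offHole (_ , _ , (ha≢hb , _) , ¬ab) = commonOut-offHole (ha≢hb ∘ cong h) ¬ab

  module _ (outdeg≤2 : ∀ v → outdeg D v ≤ 2) where

    offHole-outNeighbour-unique : ∀ {a w} → InC D h a → Arc D (h a) w → OffHole w →
                                  ∀ x → Arc D (h a) x → OffHole x → x ≡ w
    offHole-outNeighbour-unique {a} {w} a∈C a→w w∉H x a→x x∉H with x F.≟ w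
    ... | yes x≡w = x≡w
    ... | no  x≢w with inC⇒outArcAlongHole a∈C
    ...   | p , a→p = contradiction (outdeg≤2 (h a))
                        (<⇒≱ (countTrue-≥3 (D (h a)) (w∉H p) (x∉H p) (x≢w ∘ sym) a→p a→w a→x))

    chordComponent-outArc : ∀ {w a c} → OffHole w → Arc D (h a) w → InChordComp D h a c → Arc D (h c) w
    chordComponent-outArc w∉H a→w ε = a→w
    chordComponent-outArc w∉H a→w (ab@(a∈C , _) ◅ rest) with chord⇒commonOut ab
    ... | w′ , a→w′ , b→w′ =
      chordComponent-outArc w∉H
        (subst (Arc D _) (offHole-outNeighbour-unique a∈C a→w w∉H w′ a→w′ w′∉H) b→w′) rest
      where w′∉H = chord-commonOut-offHole ab (a→w′ , b→w′)

proposition2p2 : (n i : ℕ) → 1 ≤ i → (D : Digraph n) → IJDigraph D i 2 →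
    (l : ℕ) → 5 ≤ l → (h : Fin l → Fin n) → IsHole D l h →
    (a b : Fin l) → Chord D h a b →
    ∃ λ w →
      -- (1) w is the unique vertex taking care of uv, u = h a, v = h b
      (TakesCare D (h a) (h b) w × (∀ w′ → TakesCare D (h a) (h b) w′ → w′ ≡ w))
      -- (2) w is the only out-neighbour outside V(H) of each of u and v
      × (∀ k → h k ≢ w)
      × (∀ x → Arc D (h a) x → (∀ k → h k ≢ x) → x ≡ w)
      × (∀ x → Arc D (h b) x → (∀ k → h k ≢ x) → x ≡ w)
      -- (3) w is a common out-neighbour of all of V(T), and V(T) is a clique of P(D)
      × (∀ c → InChordComp D h a c → Arc D (h c) w)
      × (∀ c d → InChordComp D h a c → InChordComp D h a d → h c ≢ h d → PAdj D (h c) (h d))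
proposition2p2 n i _ D (_ , _ , outdeg≤2) l _ h hole a b ab@(a∈C , b∈C , uv , ¬ab) =
  let w , a→w , b→w = chord⇒commonOut ab
      w∉H = chord-commonOut-offHole ab (a→w , b→w)
      unique = offHole-outNeighbour-unique outdeg≤2
      T→w : ∀ c → InChordComp D h a c → Arc D (h c) w
      T→w c = chordComponent-outArc outdeg≤2 w∉H a→w
  in w
   , ( (uv , ¬ab ∘ adj⇒cConsec (proj₁ uv ∘ cong h) , a→w , b→w)
     , λ w′ (_ , _ , cw′@(a→w′ , _)) → unique a∈C a→w w∉H w′ a→w′ (chord-commonOut-offHole ab cw′))
   , w∉H
   , unique a∈C a→w w∉H
   , unique b∈C b→w w∉H
   , T→w
   , λ c d c∈T d∈T hc≢hd → hc≢hd , inj₂ (w , T→w c c∈T , T→w d d∈T)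
  where open Hole D h hole
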